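{- Let $R$, $\sigma$ and $a$ be as in the context, and write $\mathtt r^{ -1}\sigma^\infty(\mathtt r)=\mathtt w_1\mathtt w_2\mathtt w_3\ldots$ (the infinite word $\sigma^\infty(\mathtt r)$ with its first letter removed). Then for every $n\ge 1$, $a(n)-a(n-1)=1$ if $\mathtt w_n\neq\mathtt 0$ and $a(n)-a(n-1)=0$ if $\mathtt w_n=\mathtt 0$. Equivalently, applying the coding $\beta$ that sends $\mathtt 0\mapsto\mathtt 0$ and every other letter to $\mathtt 1$, the word $\beta(\mathtt r^{ -1}\sigma^\infty(\mathtt r))=\mathtt b_1\mathtt b_2\ldots$ satisfies $\mathtt b_n=[a(n)-a(n-1)]$ for all $n\ge1$.
   Context: Let $R=\langle s,r_1,r_2,\ldots\rangle$ be a sequence of nonnegative integers with $s\ge 1$. Let $\Sigma=\{\mathtt r,\mathtt 0,\mathtt 1,\mathtt 2,\ldots\}$ be the infinite alphabet consisting of a letter $\mathtt r$ together with a letter $[j]$ for each integer $j\ge 0$. For a letter $\mathtt x$ and $m\ge0$, $\mathtt x^m$ is the word of $m$ copies of $\mathtt x$. Let $\sigma$ be the morphism of words over $\Sigma$ defined by $\sigma(\mathtt r)=\mathtt r\,\mathtt 0^{s}$ and $\sigma([j])=[j+1]\,\mathtt 0^{r_{j+1}}$ for $j\ge 0$; $\sigma^\infty(\mathtt r)$ denotes the unique right-infinite word having every $\sigma^n(\mathtt r)$ as a prefix. Let $\mathcal T$ be the infinite rooted ordered tree whose root is labelled $\mathtt r$ and in which the labels of the children of any node labelled $\mathtt x$,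 read left to right, spell $\sigma(\mathtt x)$. For a node $v$, $\ell(v)$ is the number of nodes in the same row (depth) as $v$ lying strictly to its left. Define $a:\mathbb Z\to\mathbb Z_{\ge0}$ by $a(n)=0$ for $n<0$ and $a(\ell(v))=\ell(\mathrm{parent}(v))$ for every non-root node $v$ of $\mathcal T$ (this is well defined). -}

module Defs where

open import Data.Nat using (ℕ; zero; suc; _+_; _∸_; _<_; _<ᵇ_)
open import Data.Bool using (if_then_else_)
open import Data.List using (List; []; _∷_; replicate; length; concatMap)

-- Alphabet Σ = {r, 0, 1, 2, ...}:  𝕣 is the letter r,  num j is the letter [j].
data Letter : Set where
  𝕣   : Letter
  num : ℕ → Letter

-- The parameters: s and the sequence r, where  r j  is r_j  (r 0 is unused).
-- σ(r) = r 0^s ,  σ([j]) = [j+1] 0^{r_{j+1}}.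
σ : (s : ℕ) (r : ℕ → ℕ) → Letter → List Letter
σ s r 𝕣       = 𝕣 ∷ replicate s (num 0)
σ s r (num j) = num (suc j) ∷ replicate (r (suc j)) (num 0)

σ* : (s : ℕ) (r : ℕ → ℕ) → List Letter → List Letter
σ* s r = concatMap (σ s r)

-- σ^d(r).  This is also the word spelled by the labels of row d of the tree 𝒯
-- (row 0 is the root r; row d+1 is the concatenation of the children of row d,
-- i.e. σ applied to row d).
σ^ : (s : ℕ) (r : ℕ → ℕ) → ℕ → List Letter
σ^ s r zero    = 𝕣 ∷ []
σ^ s r (suc d) = σ* s r (σ^ s r d)

-- In the tree, row d+1 is obtained from row d = w by replacing each node x by its
-- children σ(x).  parentIdx w i is the position (number of nodes strictly to the
-- left) in row d of the parent of the node at position i of row d+1.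
parentIdx : (s : ℕ) (r : ℕ → ℕ) → List Letter → ℕ → ℕ
parentIdx s r []      i = 0
parentIdx s r (x ∷ w) i =
  if i <ᵇ length (σ s r x) then 0 else suc (parentIdx s r w (i ∸ length (σ s r x)))

module Submission where

open import Defs
open import Data.Nat using (ℕ; zero; suc; _<_; _≤_; _∸_; _+_; _<ᵇ_; z≤n; s≤s)
open import Data.Nat.Properties
  using (<⇒<ᵇ; <ᵇ⇒<; m+n∸m≡n; m+n≮m; +-suc; +-identityʳ; ≤-reflexive; <⇒≤;
         +-cancelˡ-<; n<1+n; <-trans)
open import Data.Bool using (true; false; T)
open import Data.Unit using (tt)
open import Data.Fin using (fromℕ<)
open import Data.List using (List; []; _∷_; length; lookup; replicate; _++_)
open import Data.List.Properties using (length-++; length-replicate)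
open import Data.Product using (_×_; _,_)
open import Data.Empty using (⊥-elim)
open import Function using (_∘_)
open import Relation.Binary.PropositionalEquality
  using (_≡_; _≢_; refl; sym; trans; cong; cong₂; subst; module ≡-Reasoning)
open ≡-Reasoning

-- Row d+1 of the tree is the concatenation of the blocks σ(x), x running over row d,
-- and every block is a nonzero letter followed by zeros.  The parent index of a node
-- is the number of the block it lies in, so from position n-1 to position n it grows
-- by one exactly when position n starts a new block, i.e. when the letter there is
-- nonzero.

β : Letter → ℕ
β 𝕣             = 1
β (num zero)    = 0
β (num (suc _)) = 1

β-≢0 : ∀ {x} → x ≢ num 0 → β x ≡ 1
β-≢0 {𝕣}           _   = refl
β-≢0 {num zero}    x≢0 = ⊥-elim (x≢0 refl)
β-≢0 {num (suc _)} _   = refl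

-- Total lookup; the value 𝕣 past the end is junk and never used.
letterAt : List Letter → ℕ → Letter
letterAt []       _       = 𝕣
letterAt (x ∷ xs) zero    = x
letterAt (x ∷ xs) (suc n) = letterAt xs n

lookup≡letterAt : ∀ xs n (n<∣xs∣ : n < length xs) → lookup xs (fromℕ< n<∣xs∣) ≡ letterAt xs n
lookup≡letterAt (x ∷ xs) zero    _             = refl
lookup≡letterAt (x ∷ xs) (suc n) (s≤s n<∣xs∣) = lookup≡letterAt xs n n<∣xs∣

letterAt-replicate-++ : ∀ c z ys {m} → m < c → letterAt (replicate c z ++ ys) m ≡ z
letterAt-replicate-++ (suc c) z ys {zero}  _         = refl
letterAt-replicate-++ (suc c) z ys {suc m} (s≤s m<c) = letterAt-replicate-++ c z ys m<c

letterAt-replicate-++-+ : ∀ c z ys j → letterAt (replicate c z ++ ys) (c + j) ≡ letterAt ys j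
letterAt-replicate-++-+ zero    z ys j = refl
letterAt-replicate-++-+ (suc c) z ys j = letterAt-replicate-++-+ c z ys j

data Position (z : ℕ) : ℕ → Set where
  inside : ∀ {n} → n < z → Position z n
  beyond : ∀ j → Position z (z + j)

position : ∀ z n → Position z n
position zero    n       = beyond n
position (suc z) zero    = inside (s≤s z≤n)
position (suc z) (suc n) with position z n
... | inside n<z = inside (s≤s n<z)
... | beyond j   = beyond j

module _ (s : ℕ) (r : ℕ → ℕ) where

  zeros : Letter → ℕ
  zeros 𝕣       = s
  zeros (num j) = r (suc j)

  length-σ : ∀ x → length (σ s r x) ≡ suc (zeros x)
  length-σ 𝕣       = cong suc (length-replicate s)
  length-σ (num j) = cong suc (length-replicate (r (suc j)))

  length-σ*-∷ : ∀ x w → length (σ* s r (x ∷ w)) ≡ suc (zeros x + length (σ* s r w))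
  length-σ*-∷ x w = trans (length-++ (σ s r x)) (cong (_+ length (σ* s r w)) (length-σ x))

  letterAt-σ-zeros : ∀ x ys {m} → m < zeros x → letterAt (σ s r x ++ ys) (suc m) ≡ num 0
  letterAt-σ-zeros 𝕣       ys = letterAt-replicate-++ s (num 0) ys
  letterAt-σ-zeros (num j) ys = letterAt-replicate-++ (r (suc j)) (num 0) ys

  letterAt-σ-beyond : ∀ x ys j → letterAt (σ s r x ++ ys) (suc (zeros x + j)) ≡ letterAt ys j
  letterAt-σ-beyond 𝕣       ys = letterAt-replicate-++-+ s (num 0) ys
  letterAt-σ-beyond (num j) ys = letterAt-replicate-++-+ (r (suc j)) (num 0) ys

  β-head-σ : ∀ y ys → β (letterAt (σ s r y ++ ys) 0) ≡ 1
  β-head-σ 𝕣       ys = refl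
  β-head-σ (num j) ys = refl

  parentIdx-inside : ∀ x w {i} → i ≤ zeros x → parentIdx s r (x ∷ w) i ≡ 0
  parentIdx-inside x w {i} i≤z with i <ᵇ length (σ s r x) in eq
  ... | true  = refl
  ... | false = ⊥-elim (subst T eq (<⇒<ᵇ (subst (i <_) (sym (length-σ x)) (s≤s i≤z))))

  parentIdx-beyond : ∀ x w j →
    parentIdx s r (x ∷ w) (suc (zeros x + j)) ≡ suc (parentIdx s r w j)
  parentIdx-beyond x w j rewrite length-σ x with zeros x + j <ᵇ zeros x in eq
  ... | true  = ⊥-elim (m+n≮m (zeros x) j (<ᵇ⇒< _ _ (subst T (sym eq) tt)))
  ... | false = cong (suc ∘ parentIdx s r w) (m+n∸m≡n (zeros x) j)

  beyond-bound : ∀ x w j → suc (zeros x + j) < length (σ* s r (x ∷ w)) → j < length (σ* s r w)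
  beyond-bound x w j h =
    +-cancelˡ-< (suc (zeros x)) j _ (subst (suc (zeros x + j) <_) (length-σ*-∷ x w) h)

  parentIdx-suc-inside : ∀ x w {n} → n < zeros x →
    parentIdx s r (x ∷ w) (suc n) ≡ β (letterAt (σ* s r (x ∷ w)) (suc n)) + parentIdx s r (x ∷ w) n
  parentIdx-suc-inside x w {n} n<z = begin
    parentIdx s r (x ∷ w) (suc n)                          ≡⟨ parentIdx-inside x w n<z ⟩
    0                                                      ≡⟨ sym (parentIdx-inside x w (<⇒≤ n<z)) ⟩
    parentIdx s r (x ∷ w) n                                ≡⟨ cong (λ c → β c + parentIdx s r (x ∷ w) n)
                                                                (sym (letterAt-σ-zeros x (σ* s r w) n<z)) ⟩
    β (letterAt (σ* s r (x ∷ w)) (suc n)) + parentIdx s r (x ∷ w) n ∎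

  parentIdx-suc-boundary : ∀ x y w → let n = zeros x + 0 in
    parentIdx s r (x ∷ y ∷ w) (suc n) ≡ β (letterAt (σ* s r (x ∷ y ∷ w)) (suc n)) + parentIdx s r (x ∷ y ∷ w) n
  parentIdx-suc-boundary x y w = begin
    parentIdx s r (x ∷ y ∷ w) (suc (zeros x + 0))          ≡⟨ parentIdx-beyond x (y ∷ w) 0 ⟩
    suc (parentIdx s r (y ∷ w) 0)                           ≡⟨ cong suc (parentIdx-inside y w z≤n) ⟩
    1                                                       ≡⟨ cong₂ _+_ (sym (β-head-σ y (σ* s r w)))
                                                                 (sym (parentIdx-inside x (y ∷ w) (≤-reflexive (+-identityʳ (zeros x))))) ⟩
    β (letterAt (σ* s r (y ∷ w)) 0) + parentIdx s r (x ∷ y ∷ w) (zeros x + 0)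
                                                            ≡⟨ cong (λ c → β c + parentIdx s r (x ∷ y ∷ w) (zeros x + 0))
                                                                 (sym (letterAt-σ-beyond x (σ* s r (y ∷ w)) 0)) ⟩
    β (letterAt (σ* s r (x ∷ y ∷ w)) (suc (zeros x + 0))) + parentIdx s r (x ∷ y ∷ w) (zeros x + 0) ∎

  parentIdx-suc : ∀ w n → suc n < length (σ* s r w) →
    parentIdx s r w (suc n) ≡ β (letterAt (σ* s r w) (suc n)) + parentIdx s r w n
  parentIdx-suc (x ∷ w) n h with position (zeros x) n
  ... | inside n<z = parentIdx-suc-inside x w n<z
  ... | beyond zero with w | beyond-bound x w 0 h
  ...   | []     | ()
  ...   | y ∷ w′ | _ = parentIdx-suc-boundary x y w′
  parentIdx-suc (x ∷ w) .(zeros x + suc j) h | beyond (suc j) = begin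
    parentIdx s r (x ∷ w) (suc (zeros x + suc j))          ≡⟨ parentIdx-beyond x w (suc j) ⟩
    suc (parentIdx s r w (suc j))                           ≡⟨ cong suc (parentIdx-suc w j (beyond-bound x w (suc j) h)) ⟩
    suc (β (letterAt (σ* s r w) (suc j)) + parentIdx s r w j)
                                                            ≡⟨ sym (+-suc _ _) ⟩
    β (letterAt (σ* s r w) (suc j)) + suc (parentIdx s r w j)
                                                            ≡⟨ cong₂ _+_ (cong β (sym (letterAt-σ-beyond x (σ* s r w) (suc j))))
                                                                 (sym (trans (cong (parentIdx s r (x ∷ w)) (+-suc (zeros x) j))
                                                                             (parentIdx-beyond x w j))) ⟩
    β (letterAt (σ* s r (x ∷ w)) (suc (zeros x + suc j))) + parentIdx s r (x ∷ w) (zeros x + suc j) ∎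

lemma3 : (s : ℕ) (r : ℕ → ℕ) → 1 ≤ s →
    (a : ℕ → ℕ) →
    (∀ d i → i < length (σ^ s r (suc d)) → a i ≡ parentIdx s r (σ^ s r d) i) →
    ∀ d n → 1 ≤ n → (h : n < length (σ^ s r d)) →
      (lookup (σ^ s r d) (fromℕ< h) ≢ num 0 → a n ≡ suc (a (n ∸ 1)))
      × (lookup (σ^ s r d) (fromℕ< h) ≡ num 0 → a n ≡ a (n ∸ 1))
lemma3 s r _ a a≡parentIdx zero    (suc n) _ (s≤s ())
lemma3 s r _ a a≡parentIdx (suc d) (suc n) _ h =
  (λ wₙ≢0 → trans increment (cong (_+ a n) (β-≢0 wₙ≢0))) ,
  (λ wₙ≡0 → trans increment (cong (λ c → β c + a n) wₙ≡0))
  where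
  increment : a (suc n) ≡ β (lookup (σ^ s r (suc d)) (fromℕ< h)) + a n
  increment = begin
    a (suc n)                                                  ≡⟨ a≡parentIdx d (suc n) h ⟩
    parentIdx s r (σ^ s r d) (suc n)                           ≡⟨ parentIdx-suc s r (σ^ s r d) n h ⟩
    β (letterAt (σ^ s r (suc d)) (suc n)) + parentIdx s r (σ^ s r d) n
                                                               ≡⟨ cong₂ _+_ (cong β (sym (lookup≡letterAt (σ^ s r (suc d)) (suc n) h)))
                                                                    (sym (a≡parentIdx d n (<-trans (n<1+n n) h))) ⟩
    β (lookup (σ^ s r (suc d)) (fromℕ< h)) + a n               ∎
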